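{- Let $w\in S_n$ and let $wk(w)$ be the number of $u\in S_n$ with $u\le w$ in the left weak Bruhat order. Then $$wk(w)\le \prod_{i=1}^n (c_i(w)+1),$$ with equality if and only if $w$ avoids the pattern $231$.
   Context: Permutations are written in one-line notation $w=w_1\cdots w_n$. The Lehmer code of $w$ is $c(w)=(c_1(w),\ldots,c_n(w))$ with $c_i(w)=\#\{j: i<j\le n,\ w_j<w_i\}$. An inversion of $w$ is a pair $(i,j)$, $i<j$, $w_i>w_j$; $\mathrm{inv}(w)$ is the number of inversions. Left weak Bruhat order: $u\le v$ if $v=s_{i_1}\cdots s_{i_k}u$ with $s_i=(i,i+1)$ (acting by composition, so $s_iw$ swaps the values $i$ and $i+1$ in $w$) and each successive left multiplication increasing $\mathrm{inv}$ by exactly one. $w$ avoids $231$ if there are no $a<b<c$ with $w_c<w_a<w_b$. -}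

module Defs where

open import Data.Nat using (ℕ; zero; suc; _+_; _*_; _<_)
open import Data.Nat.Properties using (<-trans; n<1+n)
open import Data.Fin using (Fin; toℕ; fromℕ<; _<?_) renaming (_<_ to _<ᶠ_)
open import Data.Fin.Properties using (_≟_)
open import Data.Vec using (Vec; lookup; toList)
import Data.Vec as Vec
open import Data.List using (List; []; _∷_; length; filter)
open import Data.Product using (∃-syntax; _×_)
open import Relation.Binary.PropositionalEquality using (_≡_)
open import Relation.Nullary using (¬_; yes; no)
open import Relation.Binary.Construct.Closure.ReflexiveTransitive using (Star)

-- A permutation w ∈ S_n in one-line notation: the vector (w_1,…,w_n)
-- (0-based: positions and values are Fin n), required to be injective
-- (hence bijective, n being finite).
IsPerm : ∀ {n} → Vec (Fin n) n → Set
IsPerm w = ∀ i j → lookup w i ≡ lookup w j → i ≡ j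

invL : ∀ {n} → List (Fin n) → ℕ
invL []       = 0
invL (x ∷ xs) = length (filter (_<? x) xs) + invL xs

inv : ∀ {n} → Vec (Fin n) n → ℕ
inv w = invL (toList w)

-- ∏_{i=1}^n (c_i(w) + 1), with Lehmer code c_i(w) = #{ j > i : w_j < w_i }.
lehmerProdL : ∀ {n} → List (Fin n) → ℕ
lehmerProdL []       = 1
lehmerProdL (x ∷ xs) = suc (length (filter (_<? x) xs)) * lehmerProdL xs

lehmerProd : ∀ {n} → Vec (Fin n) n → ℕ
lehmerProd w = lehmerProdL (toList w)

swapFin : ∀ {n} → Fin n → Fin n → Fin n → Fin n
swapFin a b x with x ≟ a
... | yes _ = b
... | no _ with x ≟ b
...   | yes _ = a
...   | no _  = x

-- Left multiplication by the simple transposition s_i (0-based: s_i swaps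
-- the values i and i+1, defined when i+1 < n): (s_i w)_k = s_i(w_k).
sLeft : ∀ {n} (i : ℕ) → suc i < n → Vec (Fin n) n → Vec (Fin n) n
sLeft i p w = Vec.map (swapFin (fromℕ< (<-trans (n<1+n i) p)) (fromℕ< p)) w

data _⋖_ {n} : Vec (Fin n) n → Vec (Fin n) n → Set where
  step : ∀ {u} (i : ℕ) (p : suc i < n) →
         inv (sLeft i p u) ≡ suc (inv u) → u ⋖ sLeft i p u

_≤L_ : ∀ {n} → Vec (Fin n) n → Vec (Fin n) n → Set
_≤L_ = Star _⋖_

Avoids231 : ∀ {n} → Vec (Fin n) n → Set
Avoids231 {n} w =
  ¬ (∃[ a ] ∃[ b ] ∃[ c ] (a <ᶠ b × b <ᶠ c ×
      lookup w c <ᶠ lookup w a × lookup w a <ᶠ lookup w b))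

-- Inversion sets (sets of position pairs) grow along left weak order, and conversely u ≤ w as soon as
-- Inv(u) ⊆ Inv(w): otherwise two adjacent values are in order in u but reversed in w, and swapping them
-- moves u one cover up, still below w in the inversion order. Inv(u) ⊆ Inv(w) forces c(u) ≤ c(w)
-- entrywise, and a permutation is determined by its Lehmer code, so the interval below w injects into
-- the box ∏ [0, c_i(w)], which has ∏ (c_i(w) + 1) points. If w avoids 231, c(u) ≤ c(w) conversely
-- gives Inv(u) ⊆ Inv(w), so every point of the box is the code of some u ≤ w. If w contains 231 with
-- w_a as its 2, lowering to 0 the code entry of the first later value above w_a yields a point of the
-- box that is the code of no u ≤ w.

module Submission where

open import Defs
open import Data.Nat using (ℕ; zero; suc; _+_; _*_; _≤_; _<_; z≤n; s≤s; z<s; s≤s⁻¹; s<s; s<s⁻¹; _<?_)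
open import Data.Nat.Properties
  using (module ≤-Reasoning; ≤-refl; ≤-reflexive; ≤-trans; ≤-antisym; <-trans; <-irrefl; <-≤-trans;
         <⇒≱; ≰⇒>; ≮⇒≥; ≤∧≢⇒<; <⇒≤pred; n<1+n; n≤1+n; m≤n⇒m≤1+n; n≤0⇒n≡0; m≤n⇒m<n∨m≡n;
         m≤n+m; m∸n+n≡m; +-suc; +-mono-≤; +-mono-<-≤; +-cancelˡ-≡)
open import Data.Fin as Fin using (Fin; zero; suc; toℕ; fromℕ<; punchIn; punchOut) renaming (_<_ to _<ᶠ_)
import Data.Fin.Properties as Fin
open import Data.Vec as Vec using (Vec; []; _∷_; lookup; toList)
import Data.Vec.Properties as Vec
open import Data.List as List using (List; []; _∷_; length; filter)
open import Data.List.Membership.Propositional using (_∈_)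
open import Data.List.Membership.Propositional.Properties using (∈-lookup)
open import Data.List.Relation.Unary.Unique.Propositional using (Unique)
open import Data.List.Relation.Unary.AllPairs using ([]; _∷_)
import Data.List.Relation.Unary.All as All
import Data.List.Relation.Unary.Any as Any
open import Data.List.Relation.Unary.Any.Properties using (lookup-index)
import Data.List.Properties as List
open import Data.Vec.Relation.Binary.Pointwise.Inductive as Pointwise using (Pointwise; []; _∷_)
open import Data.Sum using (_⊎_; inj₁; inj₂)
open import Data.Product using (∃; ∃₂; ∃-syntax; _×_; _,_; proj₁; proj₂)
open import Data.Empty using (⊥; ⊥-elim)
open import Function using (_∘_; id)
open import Function.Bundles using (_⇔_; mk⇔; Equivalence)
import Function.Properties.Equivalence as ⇔
open import Relation.Nullary using (¬_; yes; no; _×-dec_)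
open import Relation.Binary.Definitions using (tri<; tri≈; tri>)
open import Relation.Binary.Construct.Closure.ReflexiveTransitive using (ε; _◅_)
open import Relation.Binary.PropositionalEquality

open Equivalence using (to; from)

private variable
  k l m n s t : ℕ
  A B : Set

below : ℕ → Vec (Fin k) m → ℕ
below t []       = 0
below t (z ∷ zs) with toℕ z <? t
... | yes _ = suc (below t zs)
... | no  _ = below t zs

below-∷-< : ∀ {z} (zs : Vec (Fin k) m) → toℕ z < t → below t (z ∷ zs) ≡ suc (below t zs)
below-∷-< {t = t} {z} zs z<t with toℕ z <? t
... | yes _   = refl
... | no  z≮t = ⊥-elim (z≮t z<t)

below-∷-≮ : ∀ {z} (zs : Vec (Fin k) m) → ¬ toℕ z < t → below t (z ∷ zs) ≡ below t zs
below-∷-≮ {t = t} {z} zs z≮t with toℕ z <? t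
... | yes z<t = ⊥-elim (z≮t z<t)
... | no  _   = refl

length-filter≡below : (x : Fin k) (xs : Vec (Fin k) m) →
                      length (filter (Fin._<? x) (toList xs)) ≡ below (toℕ x) xs
length-filter≡below x [] = refl
length-filter≡below x (z ∷ zs) with toℕ z <? toℕ x
... | yes z<x = trans (cong length (List.filter-accept (Fin._<? x) z<x)) (cong suc (length-filter≡below x zs))
... | no  z≮x = trans (cong length (List.filter-reject (Fin._<? x) z≮x)) (length-filter≡below x zs)

below≤length : (zs : Vec (Fin k) m) → below t zs ≤ m
below≤length [] = z≤n
below≤length {t = t} (z ∷ zs) with toℕ z <? t
... | yes _ = s≤s (below≤length zs)
... | no  _ = m≤n⇒m≤1+n (below≤length zs)

below-∷≤suc : ∀ {z} (zs : Vec (Fin k) m) → below t (z ∷ zs) ≤ suc (below t zs)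
below-∷≤suc {t = t} {z} zs with toℕ z <? t
... | yes _ = ≤-refl
... | no  _ = n≤1+n _

below-mono : (xs : Vec (Fin k) m) (ys : Vec (Fin l) m) →
             (∀ i → toℕ (lookup xs i) < s → toℕ (lookup ys i) < t) → below s xs ≤ below t ys
below-mono [] [] _ = z≤n
below-mono {s = s} {t = t} (x ∷ xs) (y ∷ ys) h with toℕ x <? s | toℕ y <? t
... | yes _   | yes _   = s≤s (below-mono xs ys (h ∘ suc))
... | yes x<s | no  y≮t = ⊥-elim (y≮t (h zero x<s))
... | no  _   | yes _   = m≤n⇒m≤1+n (below-mono xs ys (h ∘ suc))
... | no  _   | no  _   = below-mono xs ys (h ∘ suc)

below-cong : (xs : Vec (Fin k) m) (ys : Vec (Fin l) m) →
             (∀ i → toℕ (lookup xs i) < s ⇔ toℕ (lookup ys i) < t) → below s xs ≡ below t ys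
below-cong xs ys h = ≤-antisym (below-mono xs ys (to ∘ h)) (below-mono ys xs (from ∘ h))

below-map : (f : Fin k → Fin l) (zs : Vec (Fin k) m) →
            (∀ i → toℕ (f (lookup zs i)) < t ⇔ toℕ (lookup zs i) < s) → below t (Vec.map f zs) ≡ below s zs
below-map {t = t} f zs h = below-cong (Vec.map f zs) zs
  (λ i → subst (λ v → toℕ v < t ⇔ _) (sym (Vec.lookup-map i f zs)) (h i))

below-map-suc : (f : Fin k → Fin l) (zs : Vec (Fin k) m) (q : Fin m) →
                toℕ (f (lookup zs q)) < t → ¬ toℕ (lookup zs q) < s →
                (∀ i → i ≢ q → toℕ (f (lookup zs i)) < t ⇔ toℕ (lookup zs i) < s) →
                below t (Vec.map f zs) ≡ suc (below s zs)
below-map-suc f (z ∷ zs) zero fz<t z≮s h =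
  trans (below-∷-< (Vec.map f zs) fz<t)
        (cong suc (trans (below-map f zs (λ i → h (suc i) (λ ()))) (sym (below-∷-≮ zs z≮s))))
below-map-suc {t = t} {s = s} f (z ∷ zs) (suc q) fq<t q≮s h
  with toℕ (f z) <? t | toℕ z <? s
     | below-map-suc f zs q fq<t q≮s (λ i i≢q → h (suc i) (i≢q ∘ Fin.suc-injective))
... | yes _    | yes _    | rest = cong suc rest
... | no  _    | no  _    | rest = rest
... | yes fz<t | no  z≮s′ | _    = ⊥-elim (z≮s′ (to (h zero (λ ())) fz<t))
... | no  fz≮t | yes z<s′ | _    = ⊥-elim (fz≮t (from (h zero (λ ())) z<s′))

below-pos : (zs : Vec (Fin k) m) (i : Fin m) → toℕ (lookup zs i) < t → 0 < below t zs
below-pos {t = t} (z ∷ zs) i zi<t with toℕ z <? t | i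
... | yes _   | _     = s≤s z≤n
... | no  z≮t | zero  = ⊥-elim (z≮t zi<t)
... | no  _   | suc i = below-pos zs i zi<t

below≡0 : (zs : Vec (Fin k) m) → (∀ i → ¬ toℕ (lookup zs i) < t) → below t zs ≡ 0
below≡0 [] _ = refl
below≡0 (z ∷ zs) h = trans (below-∷-≮ zs (h zero)) (below≡0 zs (h ∘ suc))

Distinct : Vec A m → Set
Distinct xs = ∀ i j → lookup xs i ≡ lookup xs j → i ≡ j

Distinct-tail : {x : A} {xs : Vec A m} → Distinct (x ∷ xs) → Distinct xs
Distinct-tail d i j e = Fin.suc-injective (d (suc i) (suc j) e)

Distinct-head∉ : {x : A} {xs : Vec A m} → Distinct (x ∷ xs) → ∀ i → lookup xs i ≢ x
Distinct-head∉ d i e with d (suc i) zero e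
... | ()

Distinct-map⁻ : (f : A → B) (xs : Vec A m) → Distinct (Vec.map f xs) → Distinct xs
Distinct-map⁻ f xs d i j e =
  d i j (trans (Vec.lookup-map i f xs) (trans (cong f e) (sym (Vec.lookup-map j f xs))))

Distinct-map : (f : A → B) → (∀ {x y} → f x ≡ f y → x ≡ y) →
               (xs : Vec A m) → Distinct xs → Distinct (Vec.map f xs)
Distinct-map f f-inj xs d i j e =
  d i j (f-inj (trans (sym (Vec.lookup-map i f xs)) (trans e (Vec.lookup-map j f xs))))

distinct⇒surjective : (u : Vec (Fin n) n) → Distinct u → ∀ v → ∃ λ r → lookup u r ≡ v
distinct⇒surjective {suc n} u d v with Fin.any? (λ r → lookup u r Fin.≟ v)
... | yes hit = hit
... | no  miss = ⊥-elim (<-irrefl refl (Fin.injective⇒≤ {f = squeeze} squeeze-injective))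
  where
  squeeze : Fin (suc n) → Fin n
  squeeze r = punchOut {i = v} (λ e → miss (r , sym e))
  squeeze-injective : ∀ {r r′} → squeeze r ≡ squeeze r′ → r ≡ r′
  squeeze-injective {r} {r′} e = d r r′ (Fin.punchOut-injective {i = v} _ _ e)

toℕ-punchIn-< : (x : Fin (suc k)) (z : Fin k) → toℕ z < toℕ x → toℕ (punchIn x z) ≡ toℕ z
toℕ-punchIn-< (suc x) zero    _         = refl
toℕ-punchIn-< (suc x) (suc z) (s<s z<x) = cong suc (toℕ-punchIn-< x z z<x)

toℕ-punchIn-≥ : (x : Fin (suc k)) (z : Fin k) → toℕ x ≤ toℕ z → toℕ (punchIn x z) ≡ suc (toℕ z)
toℕ-punchIn-≥ zero    z       _         = refl
toℕ-punchIn-≥ (suc x) (suc z) (s≤s x≤z) = cong suc (toℕ-punchIn-≥ x z x≤z)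

punchIn<⇔< : (x : Fin (suc k)) (z : Fin k) → t ≤ toℕ x → toℕ (punchIn x z) < t ⇔ toℕ z < t
punchIn<⇔< x z t≤x with toℕ z <? toℕ x
... | yes z<x rewrite toℕ-punchIn-< x z z<x = mk⇔ id id
... | no  z≮x rewrite toℕ-punchIn-≥ x z (≮⇒≥ z≮x) =
  mk⇔ (<-trans (n<1+n _)) (λ z<t → ⊥-elim (z≮x (<-≤-trans z<t t≤x)))

punchIn<suc⇔< : (x : Fin (suc k)) (z : Fin k) → toℕ x ≤ t → toℕ (punchIn x z) < suc t ⇔ toℕ z < t
punchIn<suc⇔< x z x≤t with toℕ z <? toℕ x
... | yes z<x rewrite toℕ-punchIn-< x z z<x = mk⇔ (λ _ → <-≤-trans z<x x≤t) m≤n⇒m≤1+n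
... | no  z≮x rewrite toℕ-punchIn-≥ x z (≮⇒≥ z≮x) = mk⇔ s<s⁻¹ s<s

punchIn-<⇔ : (x : Fin (suc k)) (y z : Fin k) → punchIn x z <ᶠ punchIn x y ⇔ z <ᶠ y
punchIn-<⇔ x y z = mk⇔
  (λ lt → ≰⇒> (λ y≤z → <⇒≱ lt (Fin.punchIn-mono-≤ x y z y≤z)))
  (λ lt → ≰⇒> (λ y≤z → <⇒≱ lt (Fin.punchIn-cancel-≤ x y z y≤z)))

punchOut-all : (x : Fin (suc k)) (ws : Vec (Fin (suc k)) m) → (∀ i → lookup ws i ≢ x) → Vec (Fin k) m
punchOut-all x []       _ = []
punchOut-all x (w ∷ ws) h = punchOut (λ e → h zero (sym e)) ∷ punchOut-all x ws (h ∘ suc)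

punchIn-punchOut-all : (x : Fin (suc k)) (ws : Vec (Fin (suc k)) m) (h : ∀ i → lookup ws i ≢ x) →
                       Vec.map (punchIn x) (punchOut-all x ws h) ≡ ws
punchIn-punchOut-all x []       _ = refl
punchIn-punchOut-all x (w ∷ ws) h = cong₂ _∷_ (Fin.punchIn-punchOut _) (punchIn-punchOut-all x ws (h ∘ suc))

distinct-decompose : (w : Vec (Fin (suc m)) (suc m)) → Distinct w →
                     ∃ λ ws′ → Distinct ws′ × w ≡ Vec.head w ∷ Vec.map (punchIn (Vec.head w)) ws′
distinct-decompose (x ∷ ws) d =
  ws′ , Distinct-map⁻ (punchIn x) ws′ (subst Distinct (sym reassemble) (Distinct-tail d)) ,
  cong (x ∷_) (sym reassemble)
  where
  ws′ = punchOut-all x ws (Distinct-head∉ d)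
  reassemble = punchIn-punchOut-all x ws (Distinct-head∉ d)

Distinct-∷-punchIn : (x : Fin (suc k)) (ws : Vec (Fin k) m) → Distinct ws → Distinct (x ∷ Vec.map (punchIn x) ws)
Distinct-∷-punchIn x ws d zero    zero    _ = refl
Distinct-∷-punchIn x ws d zero    (suc j) e =
  ⊥-elim (Fin.punchInᵢ≢i x (lookup ws j) (sym (trans e (Vec.lookup-map j _ ws))))
Distinct-∷-punchIn x ws d (suc i) zero    e =
  ⊥-elim (Fin.punchInᵢ≢i x (lookup ws i) (trans (sym (Vec.lookup-map i _ ws)) e))
Distinct-∷-punchIn x ws d (suc i) (suc j) e =
  cong suc (Distinct-map (punchIn x) (Fin.punchIn-injective x _ _) ws d i j e)

below-permutation : (ws : Vec (Fin m) m) → Distinct ws → k ≤ m → below k ws ≡ k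
below-permutation [] _ z≤n = refl
below-permutation {k = k} ws@(_ ∷ _) d k≤m with distinct-decompose ws d
below-permutation {k = k} (x ∷ _) d k≤m | ws′ , d′ , refl with toℕ x <? k
... | no x≮k = trans (below-map (punchIn x) ws′ (λ i → punchIn<⇔< x _ (≮⇒≥ x≮k)))
                     (below-permutation ws′ d′ (≤-trans (≮⇒≥ x≮k) (<⇒≤pred (Fin.toℕ<n x))))
below-permutation {k = suc k} (x ∷ _) d (s≤s k≤m) | ws′ , d′ , refl | yes x<k =
  cong suc (trans (below-map (punchIn x) ws′ (λ i → punchIn<suc⇔< x _ (s≤s⁻¹ x<k)))
                  (below-permutation ws′ d′ k≤m))

code : Vec (Fin k) m → Vec ℕ m
code []       = []
code (x ∷ xs) = below (toℕ x) xs ∷ code xs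

∏suc : Vec ℕ m → ℕ
∏suc []       = 1
∏suc (c ∷ cs) = suc c * ∏suc cs

invL≡sum-code : (w : Vec (Fin k) m) → invL (toList w) ≡ Vec.sum (code w)
invL≡sum-code []       = refl
invL≡sum-code (x ∷ xs) = cong₂ _+_ (length-filter≡below x xs) (invL≡sum-code xs)

lehmerProdL≡∏suc-code : (w : Vec (Fin k) m) → lehmerProdL (toList w) ≡ ∏suc (code w)
lehmerProdL≡∏suc-code []       = refl
lehmerProdL≡∏suc-code (x ∷ xs) =
  cong₂ (λ c p → suc c * p) (length-filter≡below x xs) (lehmerProdL≡∏suc-code xs)

code-map : (f : Fin k → Fin l) → (∀ y z → f z <ᶠ f y ⇔ z <ᶠ y) →
           (zs : Vec (Fin k) m) → code (Vec.map f zs) ≡ code zs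
code-map f f-order []       = refl
code-map f f-order (z ∷ zs) = cong₂ _∷_ (below-map f zs (λ i → f-order z _)) (code-map f f-order zs)

code-punchIn : (x : Fin (suc m)) (ws : Vec (Fin m) m) → Distinct ws →
               code (x ∷ Vec.map (punchIn x) ws) ≡ toℕ x ∷ code ws
code-punchIn x ws d = cong₂ _∷_ head-entry (code-map (punchIn x) (punchIn-<⇔ x) ws)
  where
  head-entry : below (toℕ x) (Vec.map (punchIn x) ws) ≡ toℕ x
  head-entry = trans (below-map (punchIn x) ws (λ i → punchIn<⇔< x _ ≤-refl))
                     (below-permutation ws d (<⇒≤pred (Fin.toℕ<n x)))

code-injective : (u w : Vec (Fin n) n) → Distinct u → Distinct w → code u ≡ code w → u ≡ w
code-injective [] [] _ _ _ = refl
code-injective u@(_ ∷ _) w du dw e with distinct-decompose u du | distinct-decompose w dw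
code-injective (x ∷ _) (y ∷ _) du dw e | u′ , du′ , refl | w′ , dw′ , refl
  with Vec.∷-injective (trans (sym (code-punchIn x u′ du′)) (trans e (code-punchIn y w′ dw′)))
... | x≡y , e′ with Fin.toℕ-injective x≡y | code-injective u′ w′ du′ dw′ e′
... | refl | refl = refl

infix 4 _≤*_
_≤*_ : Vec ℕ m → Vec ℕ m → Set
_≤*_ = Pointwise _≤_

maxCode : ∀ m → Vec ℕ m
maxCode zero    = []
maxCode (suc m) = m ∷ maxCode m

code≤maxCode : (xs : Vec (Fin k) m) → code xs ≤* maxCode m
code≤maxCode []       = []
code≤maxCode (x ∷ xs) = below≤length xs ∷ code≤maxCode xs

decode : (c : Vec ℕ m) → c ≤* maxCode m → Vec (Fin m) m
decode []       []       = []
decode (c ∷ cs) (c≤ ∷ cs≤) = fromℕ< (s≤s c≤) ∷ Vec.map (punchIn (fromℕ< (s≤s c≤))) (decode cs cs≤)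

decode-distinct : (c : Vec ℕ m) (c≤ : c ≤* maxCode m) → Distinct (decode c c≤)
decode-distinct [] [] ()
decode-distinct (c ∷ cs) (c≤ ∷ cs≤) =
  Distinct-∷-punchIn (fromℕ< (s≤s c≤)) (decode cs cs≤) (decode-distinct cs cs≤)

code-decode : (c : Vec ℕ m) (c≤ : c ≤* maxCode m) → code (decode c c≤) ≡ c
code-decode []       []         = refl
code-decode (c ∷ cs) (c≤ ∷ cs≤) =
  trans (code-punchIn (fromℕ< (s≤s c≤)) (decode cs cs≤) (decode-distinct cs cs≤))
        (cong₂ _∷_ (Fin.toℕ-fromℕ< (s≤s c≤)) (code-decode cs cs≤))

infix 4 _⊆Inv_
_⊆Inv_ : Vec (Fin k) m → Vec (Fin k) m → Set
u ⊆Inv w = ∀ p q → p <ᶠ q → lookup u q <ᶠ lookup u p → lookup w q <ᶠ lookup w p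

⊆Inv⇒code≤* : (u w : Vec (Fin k) m) → u ⊆Inv w → code u ≤* code w
⊆Inv⇒code≤* []       []       _   = []
⊆Inv⇒code≤* (y ∷ us) (x ∷ ws) u⊆w =
  below-mono us ws (λ i → u⊆w zero (suc i) z<s) ∷
  ⊆Inv⇒code≤* us ws (λ p q p<q → u⊆w (suc p) (suc q) (s<s p<q))

sum-mono-≤* : {cs ds : Vec ℕ m} → cs ≤* ds → Vec.sum cs ≤ Vec.sum ds
sum-mono-≤* []           = z≤n
sum-mono-≤* (c≤d ∷ cs≤ds) = +-mono-≤ c≤d (sum-mono-≤* cs≤ds)

≤*∧sum≡⇒≡ : {cs ds : Vec ℕ m} → cs ≤* ds → Vec.sum cs ≡ Vec.sum ds → cs ≡ ds
≤*∧sum≡⇒≡ [] _ = refl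
≤*∧sum≡⇒≡ {cs = c ∷ cs} (c≤d ∷ cs≤ds) e with m≤n⇒m<n∨m≡n c≤d
... | inj₁ c<d  = ⊥-elim (<-irrefl e (+-mono-<-≤ c<d (sum-mono-≤* cs≤ds)))
... | inj₂ refl = cong (c ∷_) (≤*∧sum≡⇒≡ cs≤ds (+-cancelˡ-≡ c _ _ e))

module AdjacentSwap (a b : Fin n) (b≡1+a : toℕ b ≡ suc (toℕ a)) where

  σ : Fin n → Fin n
  σ = swapFin a b

  data SwapView (y : Fin n) : Fin n → Set where
    at-a  : y ≡ a → SwapView y b
    at-b  : y ≡ b → SwapView y a
    fixed : y ≢ a → y ≢ b → SwapView y y

  swapView : ∀ y → SwapView y (σ y)
  swapView y with y Fin.≟ a
  ... | yes y≡a = at-a y≡a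
  ... | no  y≢a with y Fin.≟ b
  ...   | yes y≡b = at-b y≡b
  ...   | no  y≢b = fixed y≢a y≢b

  a<b : a <ᶠ b
  a<b = subst (toℕ a <_) (sym b≡1+a) (n<1+n _)

  a≢b : a ≢ b
  a≢b a≡b = <-irrefl (cong toℕ a≡b) a<b

  σa≡b : σ a ≡ b
  σa≡b with σ a | swapView a
  ... | _ | at-a _       = refl
  ... | _ | at-b a≡b     = ⊥-elim (a≢b a≡b)
  ... | _ | fixed a≢a _  = ⊥-elim (a≢a refl)

  σb≡a : σ b ≡ a
  σb≡a with σ b | swapView b
  ... | _ | at-a b≡a     = ⊥-elim (a≢b (sym b≡a))
  ... | _ | at-b _       = refl
  ... | _ | fixed _ b≢b  = ⊥-elim (b≢b refl)

  σ-fixed : ∀ {y} → y ≢ a → y ≢ b → σ y ≡ y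
  σ-fixed {y} y≢a y≢b with σ y | swapView y
  ... | _ | at-a y≡a  = ⊥-elim (y≢a y≡a)
  ... | _ | at-b y≡b  = ⊥-elim (y≢b y≡b)
  ... | _ | fixed _ _ = refl

  σ-involutive : ∀ y → σ (σ y) ≡ y
  σ-involutive y with σ y | swapView y
  ... | _ | at-a refl       = σb≡a
  ... | _ | at-b refl       = σa≡b
  ... | _ | fixed y≢a y≢b   = σ-fixed y≢a y≢b

  σ-injective : ∀ {y z} → σ y ≡ σ z → y ≡ z
  σ-injective {y} {z} e = trans (sym (σ-involutive y)) (trans (cong σ e) (σ-involutive z))

  private
    <b⇔<a : ∀ {z} → z ≢ a → z <ᶠ b ⇔ z <ᶠ a
    <b⇔<a z≢a rewrite b≡1+a =
      mk⇔ (λ z<1+a → ≤∧≢⇒< (s≤s⁻¹ z<1+a) (z≢a ∘ Fin.toℕ-injective)) m≤n⇒m≤1+n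

    a<⇔b< : ∀ {y} → y ≢ b → a <ᶠ y ⇔ b <ᶠ y
    a<⇔b< y≢b rewrite b≡1+a =
      mk⇔ (λ a<y → ≤∧≢⇒< a<y (λ e → y≢b (Fin.toℕ-injective (trans (sym e) (sym b≡1+a))))) (<-trans (n<1+n _))

    both-irrefl : ∀ {i j : ℕ} → i < i ⇔ j < j
    both-irrefl = mk⇔ (λ i<i → ⊥-elim (<-irrefl refl i<i)) (λ j<j → ⊥-elim (<-irrefl refl j<j))

  σ-order : ∀ y z → ¬ (y ≡ a × z ≡ b) → ¬ (y ≡ b × z ≡ a) → σ z <ᶠ σ y ⇔ z <ᶠ y
  σ-order y z ¬ab ¬ba with σ y | swapView y | σ z | swapView z
  ... | _ | at-a refl     | _ | at-a refl     = both-irrefl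
  ... | _ | at-a refl     | _ | at-b refl     = ⊥-elim (¬ab (refl , refl))
  ... | _ | at-a refl     | _ | fixed z≢a _   = <b⇔<a z≢a
  ... | _ | at-b refl     | _ | at-a refl     = ⊥-elim (¬ba (refl , refl))
  ... | _ | at-b refl     | _ | at-b refl     = both-irrefl
  ... | _ | at-b refl     | _ | fixed z≢a _   = ⇔.sym (<b⇔<a z≢a)
  ... | _ | fixed _ y≢b   | _ | at-a refl     = ⇔.sym (a<⇔b< y≢b)
  ... | _ | fixed _ y≢b   | _ | at-b refl     = a<⇔b< y≢b
  ... | _ | fixed _ _     | _ | fixed _ _     = mk⇔ id id


  σ-preserves-< : ∀ y z → z <ᶠ y → σ z <ᶠ σ y ⊎ (y ≡ b × z ≡ a)
  σ-preserves-< y z z<y with (y Fin.≟ b) ×-dec (z Fin.≟ a)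
  ... | yes ba  = inj₂ ba
  ... | no  ¬ba = inj₁ (from (σ-order y z ¬ab ¬ba) z<y)
    where
    ¬ab : ¬ (y ≡ a × z ≡ b)
    ¬ab (refl , refl) = <-irrefl refl (<-trans z<y a<b)

  σ-reflects-< : ∀ y z → σ z <ᶠ σ y → z <ᶠ y ⊎ (y ≡ a × z ≡ b)
  σ-reflects-< y z σz<σy with (y Fin.≟ a) ×-dec (z Fin.≟ b)
  ... | yes ab  = inj₂ ab
  ... | no  ¬ab = inj₁ (to (σ-order y z ¬ab ¬ba) σz<σy)
    where
    ¬ba : ¬ (y ≡ b × z ≡ a)
    ¬ba (refl , refl) rewrite σb≡a | σa≡b = <-irrefl refl (<-trans σz<σy a<b)

  map-σ-involutive : (xs : Vec (Fin n) m) → Vec.map σ (Vec.map σ xs) ≡ xs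
  map-σ-involutive xs = trans (sym (Vec.map-∘ σ σ xs)) (trans (Vec.map-cong σ-involutive xs) (Vec.map-id xs))

  below-σ : ∀ y (ys : Vec (Fin n) m) →
            (∀ i → ¬ (y ≡ a × lookup ys i ≡ b)) → (∀ i → ¬ (y ≡ b × lookup ys i ≡ a)) →
            below (toℕ (σ y)) (Vec.map σ ys) ≡ below (toℕ y) ys
  below-σ y ys ¬ab ¬ba = below-map σ ys (λ i → σ-order y (lookup ys i) (¬ab i) (¬ba i))

  code-σ : (ys : Vec (Fin n) m) → Distinct ys → (∀ i → lookup ys i ≢ a) → code (Vec.map σ ys) ≡ code ys
  code-σ []       _ _   = refl
  code-σ (y ∷ ys) d a∉ = cong₂ _∷_
    (below-σ y ys (λ i (y≡a , _) → a∉ zero y≡a) (λ i (_ , z≡a) → a∉ (suc i) z≡a))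
    (code-σ ys (Distinct-tail d) (a∉ ∘ suc))

  below-b-σ : (ys : Vec (Fin n) m) → Distinct ys → (∀ i → lookup ys i ≢ a) → (q : Fin m) → lookup ys q ≡ b →
              below (toℕ b) (Vec.map σ ys) ≡ suc (below (toℕ a) ys)
  below-b-σ ys d a∉ q yq≡b = below-map-suc σ ys q σb<b b≮a others
    where
    σb<b : σ (lookup ys q) <ᶠ b
    σb<b rewrite yq≡b | σb≡a = a<b
    b≮a : ¬ lookup ys q <ᶠ a
    b≮a rewrite yq≡b = λ b<a → <-irrefl refl (<-trans a<b b<a)
    others : ∀ i → i ≢ q → σ (lookup ys i) <ᶠ b ⇔ lookup ys i <ᶠ a
    others i i≢q = subst (λ v → σ (lookup ys i) <ᶠ v ⇔ _) σa≡b
      (σ-order a (lookup ys i) (λ (_ , yi≡b) → i≢q (d i q (trans yi≡b (sym yq≡b))))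
                               (λ (a≡b , _) → a≢b a≡b))

  sum-code-σ : (xs : Vec (Fin n) m) → Distinct xs → (p q : Fin m) → p <ᶠ q →
               lookup xs p ≡ a → lookup xs q ≡ b → Vec.sum (code (Vec.map σ xs)) ≡ suc (Vec.sum (code xs))
  sum-code-σ (y ∷ ys) d zero (suc q) _ refl yq≡b rewrite σa≡b =
    cong₂ _+_ (below-b-σ ys (Distinct-tail d) (Distinct-head∉ d) q yq≡b)
              (cong Vec.sum (code-σ ys (Distinct-tail d) (Distinct-head∉ d)))
  sum-code-σ (y ∷ ys) d (suc p) (suc q) (s<s p<q) yp≡a yq≡b =
    trans (cong₂ _+_ (below-σ y ys (λ i (y≡a , _) → y≢a y≡a) (λ i (y≡b , _) → y≢b y≡b))
                     (sum-code-σ ys (Distinct-tail d) p q p<q yp≡a yq≡b))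
          (+-suc _ _)
    where
    y≢a : y ≢ a
    y≢a y≡a = Distinct-head∉ d p (trans yp≡a (sym y≡a))
    y≢b : y ≢ b
    y≢b y≡b = Distinct-head∉ d q (trans yq≡b (sym y≡b))

sLeft-adjacent : ∀ i (i+1<n : suc i < n) → toℕ (fromℕ< i+1<n) ≡ suc (toℕ (fromℕ< (<-trans (n<1+n i) i+1<n)))
sLeft-adjacent i i+1<n = trans (Fin.toℕ-fromℕ< i+1<n) (cong suc (sym (Fin.toℕ-fromℕ< (<-trans (n<1+n i) i+1<n))))

-- σ changes the relative order of the positions of a and a+1 only; were they an inversion of u,
-- σ would remove an inversion instead of adding one.
⋖⇒⊆Inv : (u v : Vec (Fin n) n) → Distinct u → u ⋖ v → Distinct v × u ⊆Inv v
⋖⇒⊆Inv u _ du (step i i+1<n inv-suc) = Distinct-map σ σ-injective u du , u⊆v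
  where
  open AdjacentSwap _ _ (sLeft-adjacent i i+1<n)
  v = Vec.map σ u
  u⊆v : u ⊆Inv v
  u⊆v p q p<q uq<up with σ-preserves-< (lookup u p) (lookup u q) uq<up
  ... | inj₁ σuq<σup = subst₂ _<ᶠ_ (sym (Vec.lookup-map q σ u)) (sym (Vec.lookup-map p σ u)) σuq<σup
  ... | inj₂ (up≡b , uq≡a) = ⊥-elim (<-irrefl (trans sum-u (cong suc sum-v)) (<-trans (n<1+n _) (n<1+n _)))
    where
    sum-v : Vec.sum (code v) ≡ suc (Vec.sum (code u))
    sum-v = trans (sym (invL≡sum-code v)) (trans inv-suc (cong suc (invL≡sum-code u)))
    sum-u : Vec.sum (code u) ≡ suc (Vec.sum (code v))
    sum-u = subst (λ x → Vec.sum (code x) ≡ suc (Vec.sum (code v))) (map-σ-involutive u)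
      (sum-code-σ v (Distinct-map σ σ-injective u du) p q p<q
        (trans (Vec.lookup-map p σ u) (trans (cong σ up≡b) σb≡a))
        (trans (Vec.lookup-map q σ u) (trans (cong σ uq≡a) σa≡b)))

≤L⇒⊆Inv : {u w : Vec (Fin n) n} → Distinct u → u ≤L w → u ⊆Inv w
≤L⇒⊆Inv du ε = λ _ _ _ uq<up → uq<up
≤L⇒⊆Inv du (u⋖v ◅ v≤w) with ⋖⇒⊆Inv _ _ du u⋖v
... | dv , u⊆v = λ p q p<q uq<up → ≤L⇒⊆Inv dv v≤w p q p<q (u⊆v p q p<q uq<up)

Reversal : Vec (Fin k) m → Vec (Fin k) m → Set
Reversal u w = ∃₂ λ p q → p <ᶠ q × lookup u p <ᶠ lookup u q × lookup w q <ᶠ lookup w p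

AdjacentReversal : Vec (Fin k) m → Vec (Fin k) m → Set
AdjacentReversal u w = ∃₂ λ p q → p <ᶠ q × toℕ (lookup u q) ≡ suc (toℕ (lookup u p)) × lookup w q <ᶠ lookup w p

¬⊆Inv⇒reversal : (u w : Vec (Fin k) m) → Distinct u → ¬ w ⊆Inv u → Reversal u w
¬⊆Inv⇒reversal u w du w⊈u with Fin.any? (λ p → Fin.any? (λ q →
  (p Fin.<? q) ×-dec (lookup u p Fin.<? lookup u q) ×-dec (lookup w q Fin.<? lookup w p)))
... | yes (p , q , r) = p , q , r
... | no  none        = ⊥-elim (w⊈u w⊆u)
  where
  w⊆u : w ⊆Inv u
  w⊆u p q p<q wq<wp with Fin.<-cmp (lookup u q) (lookup u p)
  ... | tri< uq<up _ _ = uq<up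
  ... | tri≈ _ uq≡up _ = ⊥-elim (<-irrefl (cong toℕ (du p q (sym uq≡up))) p<q)
  ... | tri> _ _ up<uq = ⊥-elim (none (p , q , p<q , up<uq , wq<wp))

next-value : (u : Vec (Fin n) n) → Distinct u → ∀ p → suc (toℕ (lookup u p)) < n →
             ∃ λ r → toℕ (lookup u r) ≡ suc (toℕ (lookup u p))
next-value u du p up+1<n with distinct⇒surjective u du (fromℕ< up+1<n)
... | r , ur≡ = r , trans (cong toℕ ur≡) (Fin.toℕ-fromℕ< up+1<n)

private
  split-gap : ∀ {g x y z} → z ≡ suc g + suc x → y ≡ suc x → x < y × y < z × z ≡ g + suc y
  split-gap {g} {x} refl refl = n<1+n x , s≤s (m≤n+m (suc x) g) , sym (+-suc g (suc x))

-- Shrink the value gap u_q − u_p: wherever the value u_p + 1 sits, it forms with p or q either the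
-- wanted adjacent reversal or a reversal with a smaller gap.
reversal⇒adjacentReversal : (u w : Vec (Fin n) n) → Distinct u → u ⊆Inv w → Reversal u w → AdjacentReversal u w
reversal⇒adjacentReversal u w du u⊆w (p , q , p<q , up<uq , wq<wp) = shrink _ p q p<q (sym (m∸n+n≡m up<uq)) wq<wp
  where
  shrink : ∀ g p q → p <ᶠ q → toℕ (lookup u q) ≡ g + suc (toℕ (lookup u p)) → lookup w q <ᶠ lookup w p →
           AdjacentReversal u w
  shrink zero    p q p<q gap wq<wp = p , q , p<q , gap , wq<wp
  shrink (suc g) p q p<q gap wq<wp
    with next-value u du p (<-trans (subst (_ <_) (sym gap) (s≤s (m≤n+m _ g))) (Fin.toℕ<n (lookup u q)))
  ... | r , ur≡ with split-gap {g = g} gap ur≡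
  ... | up<ur , ur<uq , gap′ with Fin.<-cmp r p
  ...   | tri< r<p _ _  = shrink g r q (<-trans r<p p<q) gap′ (<-trans wq<wp (u⊆w r p r<p up<ur))
  ...   | tri≈ _ refl _ = ⊥-elim (<-irrefl refl up<ur)
  ...   | tri> _ _ p<r with Fin.<-cmp r q
  ...     | tri≈ _ refl _ = ⊥-elim (<-irrefl refl ur<uq)
  ...     | tri> _ _ q<r  = p , r , p<r , ur≡ , <-trans (u⊆w q r q<r ur<uq) wq<wp
  ...     | tri< r<q _ _ with lookup w r Fin.<? lookup w p
  ...       | yes wr<wp = p , r , p<r , ur≡ , wr<wp
  ...       | no  wr≮wp = shrink g r q r<q gap′ (<-≤-trans wq<wp (≮⇒≥ wr≮wp))

adjacentReversal⇒cover : (u w : Vec (Fin n) n) → Distinct u → u ⊆Inv w → AdjacentReversal u w →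
  ∃ λ v → u ⋖ v × Distinct v × v ⊆Inv w × Vec.sum (code v) ≡ suc (Vec.sum (code u))
adjacentReversal⇒cover u w du u⊆w (p , q , p<q , uq≡up+1 , wq<wp) =
  v , step i i+1<n inv-suc , Distinct-map σ σ-injective u du , v⊆w , sum-suc
  where
  i = toℕ (lookup u p)
  i+1<n : suc i < _
  i+1<n = subst (_< _) uq≡up+1 (Fin.toℕ<n (lookup u q))
  a = fromℕ< (<-trans (n<1+n i) i+1<n)
  b = fromℕ< i+1<n
  open AdjacentSwap a b (sLeft-adjacent i i+1<n)
  v = Vec.map σ u
  a≡up : a ≡ lookup u p
  a≡up = Fin.toℕ-injective (Fin.toℕ-fromℕ< _)
  b≡uq : b ≡ lookup u q
  b≡uq = Fin.toℕ-injective (trans (Fin.toℕ-fromℕ< i+1<n) (sym uq≡up+1))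
  sum-suc : Vec.sum (code v) ≡ suc (Vec.sum (code u))
  sum-suc = sum-code-σ u du p q p<q (sym a≡up) (sym b≡uq)
  inv-suc : inv v ≡ suc (inv u)
  inv-suc = trans (invL≡sum-code v) (trans sum-suc (cong suc (sym (invL≡sum-code u))))
  v⊆w : v ⊆Inv w
  v⊆w p′ q′ p′<q′ vq′<vp′
    with σ-reflects-< (lookup u p′) (lookup u q′)
           (subst₂ _<ᶠ_ (Vec.lookup-map q′ σ u) (Vec.lookup-map p′ σ u) vq′<vp′)
  ... | inj₁ uq′<up′ = u⊆w p′ q′ p′<q′ uq′<up′
  ... | inj₂ (up′≡a , uq′≡b)
    with du p′ p (trans up′≡a a≡up) | du q′ q (trans uq′≡b b≡uq)
  ...   | refl | refl = wq<wp

cover-toward : (u w : Vec (Fin n) n) → Distinct u → u ⊆Inv w → Vec.sum (code u) < Vec.sum (code w) →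
  ∃ λ v → u ⋖ v × Distinct v × v ⊆Inv w × Vec.sum (code v) ≡ suc (Vec.sum (code u))
cover-toward u w du u⊆w sum-u<sum-w =
  adjacentReversal⇒cover u w du u⊆w (reversal⇒adjacentReversal u w du u⊆w (¬⊆Inv⇒reversal u w du w⊈u))
  where
  w⊈u : ¬ w ⊆Inv u
  w⊈u w⊆u = <-irrefl refl (<-≤-trans sum-u<sum-w (sum-mono-≤* (⊆Inv⇒code≤* w u w⊆u)))

⊆Inv⇒≤L : (u w : Vec (Fin n) n) → Distinct u → Distinct w → u ⊆Inv w → u ≤L w
⊆Inv⇒≤L u w du dw u⊆w = climb _ u du u⊆w (sym (m∸n+n≡m (sum-mono-≤* (⊆Inv⇒code≤* u w u⊆w))))
  where
  climb : ∀ gap u → Distinct u → u ⊆Inv w → Vec.sum (code w) ≡ gap + Vec.sum (code u) → u ≤L w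
  climb zero u du u⊆w sums≡ =
    subst (u ≤L_) (code-injective u w du dw (≤*∧sum≡⇒≡ (⊆Inv⇒code≤* u w u⊆w) (sym sums≡))) ε
  climb (suc gap) u du u⊆w sums≡ =
    let v , u⋖v , dv , v⊆w , sum-v = cover-toward u w du u⊆w (subst (_ <_) (sym sums≡) (s≤s (m≤n+m _ gap)))
    in  u⋖v ◅ climb gap v dv v⊆w (trans sums≡ (trans (sym (+-suc gap _)) (cong (gap +_) (sym sum-v))))

Pattern231 : Vec (Fin k) m → Set
Pattern231 w = ∃[ a ] ∃[ b ] ∃[ c ] (a <ᶠ b × b <ᶠ c × lookup w c <ᶠ lookup w a × lookup w a <ᶠ lookup w b)

Begins231 : Fin k → Vec (Fin k) m → Set
Begins231 x []       = ⊥
Begins231 x (z ∷ zs) = (x <ᶠ z × ∃ λ i → lookup zs i <ᶠ x) ⊎ Begins231 x zs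

Contains231 : Vec (Fin k) m → Set
Contains231 []       = ⊥
Contains231 (x ∷ xs) = Begins231 x xs ⊎ Contains231 xs

Straddled31 : Fin k → Vec (Fin k) m → Set
Straddled31 x ws = ∃[ b ] ∃[ c ] (b <ᶠ c × lookup ws c <ᶠ x × x <ᶠ lookup ws b)

Begins231⇔Straddled31 : (x : Fin k) (ws : Vec (Fin k) m) → Begins231 x ws ⇔ Straddled31 x ws
Begins231⇔Straddled31 x ws = mk⇔ (to′ ws) (from′ ws)
  where
  to′ : (ws : Vec _ m) → Begins231 x ws → Straddled31 x ws
  to′ (z ∷ zs) (inj₁ (x<z , c , zc<x)) = zero , suc c , z<s , zc<x , x<z
  to′ (z ∷ zs) (inj₂ h) =
    let b , c , b<c , wc<x , x<wb = to′ zs h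
    in  suc b , suc c , s<s b<c , wc<x , x<wb
  from′ : (ws : Vec _ m) → Straddled31 x ws → Begins231 x ws
  from′ (z ∷ zs) (zero  , suc c , _       , zc<x , x<z)  = inj₁ (x<z , c , zc<x)
  from′ (z ∷ zs) (suc b , suc c , s<s b<c , wc<x , x<wb) = inj₂ (from′ zs (b , c , b<c , wc<x , x<wb))

Contains231⇔Pattern231 : (w : Vec (Fin k) m) → Contains231 w ⇔ Pattern231 w
Contains231⇔Pattern231 w = mk⇔ (to′ w) (from′ w)
  where
  to′ : (w : Vec _ m) → Contains231 w → Pattern231 w
  to′ (x ∷ ws) (inj₁ h) =
    let b , c , b<c , wc<x , x<wb = to (Begins231⇔Straddled31 x ws) h
    in  zero , suc b , suc c , z<s , s<s b<c , wc<x , x<wb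
  to′ (x ∷ ws) (inj₂ h) =
    let a , b , c , a<b , b<c , wc<wa , wa<wb = to′ ws h
    in  suc a , suc b , suc c , s<s a<b , s<s b<c , wc<wa , wa<wb
  from′ : (w : Vec _ m) → Pattern231 w → Contains231 w
  from′ (x ∷ ws) (zero  , suc b , suc c , _       , s<s b<c , wc<wa , wa<wb) =
    inj₁ (from (Begins231⇔Straddled31 x ws) (b , c , b<c , wc<wa , wa<wb))
  from′ (x ∷ ws) (suc a , suc b , suc c , s<s a<b , s<s b<c , wc<wa , wa<wb) =
    inj₂ (from′ ws (a , b , c , a<b , b<c , wc<wa , wa<wb))

-- Without a 231 starting at x, the entries of ws below x form an initial segment of ws.
head-inversions-⊆ : (x y : Fin k) (us ws : Vec (Fin k) m) → ¬ Begins231 x ws → (∀ i → lookup ws i ≢ x) →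
  code us ≤* code ws → below (toℕ y) us ≤ below (toℕ x) ws →
  ∀ i → lookup us i <ᶠ y → lookup ws i <ᶠ x
head-inversions-⊆ x y (v ∷ vs) (z ∷ zs) no231 x∉ (v≤z ∷ vs≤zs) counts i ui<y with toℕ z <? toℕ x
head-inversions-⊆ x y (v ∷ vs) (z ∷ zs) no231 x∉ (v≤z ∷ vs≤zs) counts zero    _    | yes z<x = z<x
head-inversions-⊆ x y (v ∷ vs) (z ∷ zs) no231 x∉ (v≤z ∷ vs≤zs) counts (suc i) ui<y | yes z<x =
  head-inversions-⊆ x y vs zs (no231 ∘ inj₂) (x∉ ∘ suc) vs≤zs counts′ i ui<y
  where
  counts′ : below (toℕ y) vs ≤ below (toℕ x) zs
  counts′ with toℕ v <? toℕ y
  ... | yes _   = s≤s⁻¹ counts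
  ... | no  v≮y = begin
    below (toℕ y) vs  ≤⟨ below-mono vs vs (λ _ w<y → <-≤-trans w<y (≮⇒≥ v≮y)) ⟩
    below (toℕ v) vs  ≤⟨ v≤z ⟩
    below (toℕ z) zs  ≤⟨ below-mono zs zs (λ _ w<z → <-trans w<z z<x) ⟩
    below (toℕ x) zs  ∎
    where open ≤-Reasoning
... | no z≮x = ⊥-elim (<-irrefl (sym nothing-below-y) (below-pos (v ∷ vs) i ui<y))
  where
  x<z : x <ᶠ z
  x<z = ≤∧≢⇒< (≮⇒≥ z≮x) (λ e → x∉ zero (Fin.toℕ-injective (sym e)))
  nothing-below-y : below (toℕ y) (v ∷ vs) ≡ 0
  nothing-below-y =
    n≤0⇒n≡0 (≤-trans counts (≤-reflexive (below≡0 zs (λ j zj<x → no231 (inj₁ (x<z , j , zj<x))))))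

avoids231⇒⊆Inv : (u w : Vec (Fin k) m) → Distinct w → ¬ Contains231 w → code u ≤* code w → u ⊆Inv w
avoids231⇒⊆Inv (y ∷ us) (x ∷ ws) dw no231 (y≤x ∷ us≤ws) zero (suc q) _ uq<up =
  head-inversions-⊆ x y us ws (no231 ∘ inj₁) (Distinct-head∉ dw) us≤ws y≤x q uq<up
avoids231⇒⊆Inv (y ∷ us) (x ∷ ws) dw no231 (_ ∷ us≤ws) (suc p) (suc q) (s<s p<q) uq<up =
  avoids231⇒⊆Inv us ws (Distinct-tail dw) (no231 ∘ inj₂) us≤ws p q p<q uq<up

UnreachableTail : Fin k → Vec (Fin k) m → Vec ℕ m → Set
UnreachableTail {k} {m} x ws c =
  ∀ (y : Fin k) (us : Vec (Fin k) m) → code us ≡ c → below (toℕ x) ws ≤ below (toℕ y) us →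
  ¬ (∀ i → lookup us i <ᶠ y → lookup ws i <ᶠ x)

unreachableTail-here : ∀ {x z : Fin k} (zs : Vec (Fin k) m) → x <ᶠ z → (∃ λ i → lookup zs i <ᶠ x) →
                       UnreachableTail x (z ∷ zs) (0 ∷ code zs)
unreachableTail-here {x = x} {z} zs x<z (i , zi<x) y (v ∷ vs) code≡ counts incl = <-irrefl refl (begin-strict
  0                        <⟨ below-pos zs i zi<x ⟩
  below (toℕ x) zs         ≡⟨ below-∷-≮ zs z≮x ⟨
  below (toℕ x) (z ∷ zs)   ≤⟨ counts ⟩
  below (toℕ y) (v ∷ vs)   ≡⟨ below-∷-≮ vs v≮y ⟩
  below (toℕ y) vs         ≤⟨ below-mono vs vs (λ _ w<y → <-≤-trans w<y (≮⇒≥ v≮y)) ⟩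
  below (toℕ v) vs         ≡⟨ Vec.∷-injectiveˡ code≡ ⟩
  0                        ∎)
  where
  open ≤-Reasoning
  z≮x : ¬ z <ᶠ x
  z≮x z<x = <-irrefl refl (<-trans x<z z<x)
  v≮y : ¬ v <ᶠ y
  v≮y = z≮x ∘ incl zero

unreachableTail-there : ∀ {x z : Fin k} (zs : Vec (Fin k) m) {c} → z <ᶠ x → UnreachableTail x zs c →
                        UnreachableTail x (z ∷ zs) (below (toℕ z) zs ∷ c)
unreachableTail-there zs z<x unreachable y (v ∷ vs) code≡ counts incl =
  unreachable y vs (Vec.∷-injectiveʳ code≡)
    (s≤s⁻¹ (≤-trans (≤-reflexive (sym (below-∷-< zs z<x))) (≤-trans counts (below-∷≤suc vs))))
    (incl ∘ suc)

-- c is the code of ws with the entry of the first value above x lowered to 0.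
begins231⇒unreachableTail : (x : Fin k) (ws : Vec (Fin k) m) → (∀ i → lookup ws i ≢ x) → Begins231 x ws →
                            ∃ λ c → c ≤* code ws × UnreachableTail x ws c
begins231⇒unreachableTail x (z ∷ zs) x∉ (inj₁ (x<z , smaller-later)) =
  0 ∷ code zs , z≤n ∷ Pointwise.refl ≤-refl , unreachableTail-here zs x<z smaller-later
begins231⇒unreachableTail x (z ∷ zs) x∉ (inj₂ h) with toℕ x <? toℕ z
... | yes x<z =
  let _ , c , _ , zc<x , _ = to (Begins231⇔Straddled31 x zs) h
  in  0 ∷ code zs , z≤n ∷ Pointwise.refl ≤-refl , unreachableTail-here zs x<z (c , zc<x)
... | no  x≮z =
  let c , c≤ , unreachable = begins231⇒unreachableTail x zs (x∉ ∘ suc) h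
  in  below (toℕ z) zs ∷ c , ≤-refl ∷ c≤ , unreachableTail-there zs z<x unreachable
  where
  z<x : z <ᶠ x
  z<x = ≤∧≢⇒< (≮⇒≥ x≮z) (λ e → x∉ zero (Fin.toℕ-injective e))

contains231⇒unreachableCode : (w : Vec (Fin k) m) → Distinct w → Contains231 w →
  ∃ λ c → c ≤* code w × (∀ u → code u ≡ c → ¬ u ⊆Inv w)
contains231⇒unreachableCode (x ∷ ws) dw (inj₁ h) =
  let c , c≤ , unreachable = begins231⇒unreachableTail x ws (Distinct-head∉ dw) h
  in  below (toℕ x) ws ∷ c , ≤-refl ∷ c≤ ,
      λ { (y ∷ us) code≡ u⊆w → unreachable y us (Vec.∷-injectiveʳ code≡)
            (≤-reflexive (sym (Vec.∷-injectiveˡ code≡))) (λ i → u⊆w zero (suc i) z<s) }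
contains231⇒unreachableCode (x ∷ ws) dw (inj₂ h) =
  let c , c≤ , unreachable = contains231⇒unreachableCode ws (Distinct-tail dw) h
  in  below (toℕ x) ws ∷ c , ≤-refl ∷ c≤ ,
      λ { (y ∷ us) code≡ u⊆w →
            unreachable us (Vec.∷-injectiveʳ code≡) (λ p q p<q → u⊆w (suc p) (suc q) (s<s p<q)) }

encode : {cs ds : Vec ℕ m} → cs ≤* ds → Fin (∏suc ds)
encode []            = zero
encode (c≤d ∷ cs≤ds) = Fin.combine (fromℕ< (s≤s c≤d)) (encode cs≤ds)

encode-cong : {cs cs′ ds : Vec ℕ m} (p : cs ≤* ds) (p′ : cs′ ≤* ds) → cs ≡ cs′ → encode p ≡ encode p′
encode-cong []      []        refl = refl
encode-cong (c≤d ∷ p) (_ ∷ p′) refl = cong (Fin.combine (fromℕ< (s≤s c≤d))) (encode-cong p p′ refl)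

encode-injective : {cs cs′ ds : Vec ℕ m} (p : cs ≤* ds) (p′ : cs′ ≤* ds) → encode p ≡ encode p′ → cs ≡ cs′
encode-injective []          []            _ = refl
encode-injective (c≤d ∷ p) (c′≤d ∷ p′) e =
  let head≡ , tail≡ = Fin.combine-injective _ _ _ _ e
  in  cong₂ _∷_
        (trans (sym (Fin.toℕ-fromℕ< (s≤s c≤d))) (trans (cong toℕ head≡) (Fin.toℕ-fromℕ< (s≤s c′≤d))))
        (encode-injective p p′ tail≡)

encode-surjective : (ds : Vec ℕ m) (k : Fin (∏suc ds)) → ∃ λ cs → ∃ λ (p : cs ≤* ds) → encode p ≡ k
encode-surjective []       zero = [] , [] , refl
encode-surjective (d ∷ ds) k =
  let i , j , combine≡ = Fin.combine-surjective k
      cs , p , encode≡ = encode-surjective ds j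
  in  toℕ i ∷ cs , s≤s⁻¹ (Fin.toℕ<n i) ∷ p ,
      trans (cong₂ Fin.combine (Fin.fromℕ<-toℕ i _) encode≡) combine≡

Unique⇒lookup-injective : (xs : List A) → Unique xs → ∀ {i j} → List.lookup xs i ≡ List.lookup xs j → i ≡ j
Unique⇒lookup-injective (x ∷ xs) (x∉ ∷ u) {zero}  {zero}  _ = refl
Unique⇒lookup-injective (x ∷ xs) (x∉ ∷ u) {zero}  {suc j} e = ⊥-elim (All.lookup x∉ (∈-lookup j) e)
Unique⇒lookup-injective (x ∷ xs) (x∉ ∷ u) {suc i} {zero}  e = ⊥-elim (All.lookup x∉ (∈-lookup i) (sym e))
Unique⇒lookup-injective (x ∷ xs) (x∉ ∷ u) {suc i} {suc j} e = cong suc (Unique⇒lookup-injective xs u e)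

injective∧missing⇒< : (f : Fin l → Fin n) → (∀ {i j} → f i ≡ f j → i ≡ j) →
                      (v : Fin n) → (∀ i → f i ≢ v) → l < n
injective∧missing⇒< {n = suc n} f f-inj v miss =
  s≤s (Fin.injective⇒≤ {f = λ i → punchOut (miss i ∘ sym)}
                       (λ e → f-inj (Fin.punchOut-injective {i = v} _ _ e)))

module LowerInterval {n} (w : Vec (Fin n) n) (dw : Distinct w) (L : List (Vec (Fin n) n)) (uL : Unique L)
                     (L-interval : ∀ u → (u ∈ L) ⇔ (IsPerm u × u ≤L w)) where

  entry-distinct : ∀ i → Distinct (List.lookup L i)
  entry-distinct i = proj₁ (to (L-interval _) (∈-lookup i))

  entry-⊆Inv : ∀ i → List.lookup L i ⊆Inv w
  entry-⊆Inv i = ≤L⇒⊆Inv (entry-distinct i) (proj₂ (to (L-interval _) (∈-lookup i)))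

  entry-code≤ : ∀ i → code (List.lookup L i) ≤* code w
  entry-code≤ i = ⊆Inv⇒code≤* _ w (entry-⊆Inv i)

  index : Fin (length L) → Fin (∏suc (code w))
  index i = encode (entry-code≤ i)

  index-injective : ∀ {i j} → index i ≡ index j → i ≡ j
  index-injective {i} {j} e = Unique⇒lookup-injective L uL
    (code-injective _ _ (entry-distinct i) (entry-distinct j) (encode-injective (entry-code≤ i) (entry-code≤ j) e))

  length≤ : length L ≤ ∏suc (code w)
  length≤ = Fin.injective⇒≤ index-injective

  contains231⇒length< : Contains231 w → length L < ∏suc (code w)
  contains231⇒length< has231 =
    let c , c≤ , unreachable = contains231⇒unreachableCode w dw has231
    in  injective∧missing⇒< index index-injective (encode c≤)
          (λ i e → unreachable _ (encode-injective (entry-code≤ i) c≤ e) (entry-⊆Inv i))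

  module _ (no231 : ¬ Contains231 w) where

    reach : ∀ {cs} → cs ≤* code w → Vec (Fin n) n
    reach {cs} p = decode cs (Pointwise.trans ≤-trans p (code≤maxCode w))

    code-reach : ∀ {cs} (p : cs ≤* code w) → code (reach p) ≡ cs
    code-reach {cs} p = code-decode cs _

    reach-∈ : ∀ {cs} (p : cs ≤* code w) → reach p ∈ L
    reach-∈ {cs} p = from (L-interval (reach p)) (du , ⊆Inv⇒≤L (reach p) w du dw u⊆w)
      where
      du = decode-distinct cs _
      u⊆w = avoids231⇒⊆Inv (reach p) w dw no231 (subst (_≤* code w) (sym (code-reach p)) p)

    codeAt : Fin (∏suc (code w)) → Vec ℕ n
    codeAt k = proj₁ (encode-surjective (code w) k)

    codeAt≤ : ∀ k → codeAt k ≤* code w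
    codeAt≤ k = proj₁ (proj₂ (encode-surjective (code w) k))

    encode-codeAt : ∀ k → encode (codeAt≤ k) ≡ k
    encode-codeAt k = proj₂ (proj₂ (encode-surjective (code w) k))

    position : Fin (∏suc (code w)) → Fin (length L)
    position k = Any.index (reach-∈ (codeAt≤ k))

    position-injective : ∀ {k k′} → position k ≡ position k′ → k ≡ k′
    position-injective {k} {k′} e = begin
      k                     ≡⟨ encode-codeAt k ⟨
      encode (codeAt≤ k)    ≡⟨ encode-cong (codeAt≤ k) (codeAt≤ k′) codes≡ ⟩
      encode (codeAt≤ k′)   ≡⟨ encode-codeAt k′ ⟩
      k′                    ∎
      where
      open ≡-Reasoning
      reach≡ : reach (codeAt≤ k) ≡ reach (codeAt≤ k′)
      reach≡ = trans (lookup-index (reach-∈ (codeAt≤ k)))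
                     (trans (cong (List.lookup L) e) (sym (lookup-index (reach-∈ (codeAt≤ k′)))))
      codes≡ : codeAt k ≡ codeAt k′
      codes≡ = trans (sym (code-reach (codeAt≤ k))) (trans (cong code reach≡) (code-reach (codeAt≤ k′)))

    avoids231⇒length≥ : ∏suc (code w) ≤ length L
    avoids231⇒length≥ = Fin.injective⇒≤ position-injective

proposition1p3 : ∀ (n : ℕ) (w : Vec (Fin n) n) → IsPerm w →
    (L : List (Vec (Fin n) n)) → Unique L →
    (∀ u → (u ∈ L) ⇔ (IsPerm u × u ≤L w)) →
    (length L ≤ lehmerProd w) × ((length L ≡ lehmerProd w) ⇔ Avoids231 w)
proposition1p3 n w dw L uL L-interval =
  subst (length L ≤_) ∏≡lehmerProd length≤ , mk⇔ equality⇒avoids avoids⇒equality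
  where
  open LowerInterval w dw L uL L-interval
  ∏≡lehmerProd : ∏suc (code w) ≡ lehmerProd w
  ∏≡lehmerProd = sym (lehmerProdL≡∏suc-code w)
  equality⇒avoids : length L ≡ lehmerProd w → Avoids231 w
  equality⇒avoids e has-pattern =
    <-irrefl (trans e (sym ∏≡lehmerProd)) (contains231⇒length< (from (Contains231⇔Pattern231 w) has-pattern))
  avoids⇒equality : Avoids231 w → length L ≡ lehmerProd w
  avoids⇒equality avoids =
    trans (≤-antisym length≤ (avoids231⇒length≥ (avoids ∘ to (Contains231⇔Pattern231 w)))) ∏≡lehmerProd
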